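{- Let $\sigma$ be a tournament on a finite vertex set $V_\sigma$, and let $v,w\in V_\sigma$ be two distinct vertices such that $sd_{\sigma}(v)\geq sd_{\sigma}(w)$, and put $k=i_{\sigma}(w)-i_{\sigma}(v)$. Let $\tau$ be the tournament on $V_\sigma$ obtained from $\sigma$ by reversing the direction of the edge between $v$ and $w$ (all other edges unchanged). Then: (1) if the edge $(v,w)$ (directed from $v$ to $w$) is in $\sigma$, then $\tau$ has $k-1$ more regular $3$-cycles than $\sigma$, i.e. $c_3(\tau)-c_3(\sigma)=k-1$; (2) if the edge $(w,v)$ (directed from $w$ to $v$) is in $\sigma$, then $\tau$ has $k+1$ fewer regular $3$-cycles than $\sigma$, i.e. $c_3(\sigma)-c_3(\tau)=k+1$.
   Context: An $n$-tournament is a directed graph with no reciprocal edges whose underlying undirected graph is the complete graph on its $n$ vertices (so between any two distinct vertices there is exactly one directed edge). A tournament is regular if every vertex has equal in-degree and out-degree; a regular $3$-sub-tournament (regular $3$-cycle) of $\sigma$ is a set of three vertices whose induced sub-tournament is a directed cycle $a\to b\to c\to a$. $c_3(\sigma)$ denotes the number of regular $3$-sub-tournaments of $\sigma$. For a vertex $u$: $i_{\sigma}(u)$ is the in-degree (number of edges coming into $u$), $o_{\sigma}(u)$ the out-degree, and $sd_{\sigma}(u)=i_{\sigma}(u)-o_{\sigma}(u)$ the signed degree. -}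

module Defs where

open import Data.Nat using (ℕ; _<_)
open import Data.Bool using (Bool; true; false; not; _∧_; _∨_; if_then_else_)
open import Data.Fin using (Fin; _≟_; _<?_)
open import Data.List using (List; length; filter; allFin; concatMap; map; sum)
open import Data.Integer using (ℤ; +_; _-_)
open import Data.Product using (_×_; _,_)
open import Relation.Binary.PropositionalEquality using (_≡_; _≢_)
open import Relation.Nullary using (¬_)
open import Relation.Nullary.Decidable using (⌊_⌋)

-- A directed graph on the vertex set Fin n, given by its (decidable) edge
-- relation: E x y ≡ true  iff  there is an edge x → y.
Digraph : ℕ → Set
Digraph n = Fin n → Fin n → Bool

record IsTournament {n : ℕ} (E : Digraph n) : Set where
  field
    irreflexive : ∀ x → E x x ≡ false
    antisym     : ∀ x y → E x y ≡ true → E y x ≡ false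
    complete    : ∀ x y → x ≢ y → E x y ≡ false → E y x ≡ true

indeg : {n : ℕ} → Digraph n → Fin n → ℕ
indeg {n} E u = length (filter (λ x → E x u Data.Bool.≟ true) (allFin n))

outdeg : {n : ℕ} → Digraph n → Fin n → ℕ
outdeg {n} E u = length (filter (λ y → E u y Data.Bool.≟ true) (allFin n))

sd : {n : ℕ} → Digraph n → Fin n → ℤ
sd E u = (+ indeg E u) - (+ outdeg E u)

isCyclic : {n : ℕ} → Digraph n → Fin n → Fin n → Fin n → Bool
isCyclic E a b c =
  (E a b ∧ E b c ∧ E c a) ∨ (E a c ∧ E c b ∧ E b a)

triples : (n : ℕ) → List (Fin n × Fin n × Fin n)
triples n =
  concatMap (λ a → concatMap (λ b → map (λ c → (a , b , c))
      (filter (λ c → b <? c) (allFin n)))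
    (filter (λ b → a <? b) (allFin n)))
  (allFin n)

c3 : {n : ℕ} → Digraph n → ℕ
c3 {n} E = length (filter (λ { (a , b , c) → isCyclic E a b c Data.Bool.≟ true }) (triples n))

reverseEdge : {n : ℕ} → Digraph n → Fin n → Fin n → Digraph n
reverseEdge E v w x y =
  if (⌊ x ≟ v ⌋ ∧ ⌊ y ≟ w ⌋) ∨ (⌊ x ≟ w ⌋ ∧ ⌊ y ≟ v ⌋)
  then E y x
  else E x y

{-# OPTIONS --safe #-}
-- Reversing the edge between v and w can only change the status of the triangles {v, w, x}.
-- Writing c₃ as a sum over increasing triples, a symmetric function supported on the triples
-- containing both v and w sums to the sum over x of its value at (v, w, x). If v → w, the
-- triangle {v, w, x} is cyclic before the reversal iff w → x → v and after it iff v → x → w,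
-- so in a tournament it contributes [x → w] − [x → v]; summed over x ∉ {v, w} this is
-- (i(w) − 1) − i(v) = k − 1. Reversing the edge between w and v is the same operation, so the
-- case w → v is the first case for the pair (w, v), where k becomes −k.
module Submission where

open import Defs
open import Data.Nat using (ℕ; zero; suc)
open import Data.Fin using (Fin; zero; suc; _≟_; _<?_; _<_)
open import Data.Fin.Properties using (<-cmp; <-trans; <-asym; <-irrefl; <⇒≢)
open import Data.Sum using (_⊎_; inj₁; inj₂)
open import Data.Bool using (Bool; true; false; not; _∧_; _∨_; if_then_else_)
open import Data.Bool.Properties using (∧-comm; ∧-assoc; ∧-zeroʳ; ∨-comm; ∨-identityʳ)
import Data.Bool as Bool
open import Data.List using (List; []; _∷_; _++_; length; filter; allFin; concatMap; map; tabulate)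
open import Data.Integer using (ℤ; +_; _-_; _+_; _*_; -_; _≤_; 0ℤ; 1ℤ)
open import Data.Integer.Properties
  using (+-*-semiring; +-identityˡ; +-identityʳ; +-assoc; +-inverseʳ; *-zeroˡ; *-zeroʳ; *-identityˡ; *-identityʳ)
open import Algebra.Properties.Semiring.Sum +-*-semiring
  using (sum; sum-syntax; ∑-distrib-+; *-distribˡ-sum; sum-cong-≗; sum-replicate-zero)
open import Data.Integer.Tactic.RingSolver using (solve-∀)
open import Data.Product using (_×_; _,_)
open import Data.Empty using (⊥; ⊥-elim)
open import Data.Unit using (⊤; tt)
open import Relation.Binary using (tri<; tri≈; tri>)
open import Function using (_∘_; id)
open import Level using (Level)
open import Relation.Binary.PropositionalEquality
open import Relation.Nullary using (Dec; does; yes; no; ¬_)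
open import Relation.Nullary.Decidable using (⌊_⌋; dec-true; dec-false)
open import Relation.Unary using (Pred; Decidable)

𝟙 : Bool → ℤ
𝟙 true  = 1ℤ
𝟙 false = 0ℤ

𝟙-does-≟-true : ∀ b → 𝟙 (does (b Bool.≟ true)) ≡ 𝟙 b
𝟙-does-≟-true true  = refl
𝟙-does-≟-true false = refl

𝟙-not-∧-difference : ∀ p q → 𝟙 (not p ∧ q) - 𝟙 (not q ∧ p) ≡ 𝟙 q - 𝟙 p
𝟙-not-∧-difference false false = refl
𝟙-not-∧-difference false true  = refl
𝟙-not-∧-difference true  false = refl
𝟙-not-∧-difference true  true  = refl

δ : ∀ {n} → Fin n → Fin n → ℤ
δ x y = 𝟙 (does (x ≟ y))

δ-refl : ∀ {n} (x : Fin n) → δ x x ≡ 1ℤ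
δ-refl x rewrite dec-true (x ≟ x) refl = refl

δ-≢ : ∀ {n} {x y : Fin n} → x ≢ y → δ x y ≡ 0ℤ
δ-≢ {x = x} {y} x≢y rewrite dec-false (x ≟ y) x≢y = refl

∑ₗ : {A : Set} → (A → ℤ) → List A → ℤ
∑ₗ f []       = 0ℤ
∑ₗ f (x ∷ xs) = f x + ∑ₗ f xs

module _ {A : Set} {ℓ : Level} {P : Pred A ℓ} (P? : Decidable P) where

  length-filter : ∀ xs → + length (filter P? xs) ≡ ∑ₗ (𝟙 ∘ does ∘ P?) xs
  length-filter [] = refl
  length-filter (x ∷ xs) with does (P? x)
  ... | true  = cong (_+_ 1ℤ) (length-filter xs)
  ... | false = trans (length-filter xs) (sym (+-identityˡ _))

  ∑ₗ-filter : ∀ (f : A → ℤ) xs → ∑ₗ f (filter P? xs) ≡ ∑ₗ (λ x → 𝟙 (does (P? x)) * f x) xs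
  ∑ₗ-filter f [] = refl
  ∑ₗ-filter f (x ∷ xs) with does (P? x)
  ... | true  = cong₂ _+_ (sym (*-identityˡ (f x))) (∑ₗ-filter f xs)
  ... | false rewrite *-zeroˡ (f x) = trans (∑ₗ-filter f xs) (sym (+-identityˡ _))

∑ₗ-map : {A B : Set} (f : B → ℤ) (g : A → B) (xs : List A) → ∑ₗ f (map g xs) ≡ ∑ₗ (f ∘ g) xs
∑ₗ-map f g []       = refl
∑ₗ-map f g (x ∷ xs) = cong (_+_ (f (g x))) (∑ₗ-map f g xs)

∑ₗ-++ : {A : Set} (f : A → ℤ) (xs ys : List A) → ∑ₗ f (xs ++ ys) ≡ ∑ₗ f xs + ∑ₗ f ys
∑ₗ-++ f []       ys = sym (+-identityˡ _)
∑ₗ-++ f (x ∷ xs) ys = trans (cong (_+_ (f x)) (∑ₗ-++ f xs ys)) (sym (+-assoc (f x) _ _))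

∑ₗ-concatMap : {A B : Set} (f : B → ℤ) (g : A → List B) (xs : List A) →
  ∑ₗ f (concatMap g xs) ≡ ∑ₗ (∑ₗ f ∘ g) xs
∑ₗ-concatMap f g []       = refl
∑ₗ-concatMap f g (x ∷ xs) =
  trans (∑ₗ-++ f (g x) (concatMap g xs)) (cong (_+_ (∑ₗ f (g x))) (∑ₗ-concatMap f g xs))

∑ₗ-tabulate : {A : Set} {n : ℕ} (f : A → ℤ) (g : Fin n → A) → ∑ₗ f (tabulate g) ≡ sum (f ∘ g)
∑ₗ-tabulate {n = zero}  f g = refl
∑ₗ-tabulate {n = suc n} f g = cong (_+_ (f (g zero))) (∑ₗ-tabulate f (g ∘ suc))

∑ₗ-allFin : ∀ {n} (f : Fin n → ℤ) → ∑ₗ f (allFin n) ≡ sum f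
∑ₗ-allFin f = ∑ₗ-tabulate f id

∑-δ : ∀ {n} (m : Fin n) (f : Fin n → ℤ) → ∑[ x < n ] (δ x m * f x) ≡ f m
∑-δ {suc n} zero f =
  trans (cong₂ _+_ (*-identityˡ (f zero))
                   (trans (sum-cong-≗ (λ x → *-zeroˡ (f (suc x)))) (sum-replicate-zero n)))
        (+-identityʳ (f zero))
∑-δ {suc n} (suc m) f =
  trans (cong₂ _+_ (*-zeroˡ (f zero)) (∑-δ m (f ∘ suc))) (+-identityˡ (f (suc m)))

∑-δ-one : ∀ {n} (m : Fin n) → ∑[ x < n ] δ x m ≡ 1ℤ
∑-δ-one m = trans (sum-cong-≗ λ x → sym (*-identityʳ (δ x m))) (∑-δ m (λ _ → 1ℤ))

∑-distrib-minus : ∀ {n} (f g : Fin n → ℤ) → ∑[ x < n ] (f x - g x) ≡ sum f - sum g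
∑-distrib-minus {zero}  f g = refl
∑-distrib-minus {suc n} f g =
  trans (cong (_+_ (f zero - g zero)) (∑-distrib-minus (f ∘ suc) (g ∘ suc)))
        (interchange (f zero) (g zero) (sum (f ∘ suc)) (sum (g ∘ suc)))
  where
  interchange : ∀ a b c d → a - b + (c - d) ≡ a + c - (b + d)
  interchange = solve-∀

Ternary : ℕ → Set
Ternary n = Fin n → Fin n → Fin n → ℤ

∑³ : ∀ {n} → Ternary n → ℤ
∑³ {n} F = ∑[ a < n ] ∑[ b < n ] ∑[ c < n ] F a b c

∑³-distrib-+ : ∀ {n} (F G : Ternary n) →
  ∑³ (λ a b c → F a b c + G a b c) ≡ ∑³ F + ∑³ G
∑³-distrib-+ F G = trans
  (sum-cong-≗ λ a → trans (sum-cong-≗ λ b → ∑-distrib-+ (F a b) (G a b))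
                          (∑-distrib-+ (λ b → sum (F a b)) (λ b → sum (G a b))))
  (∑-distrib-+ (λ a → ∑[ b < _ ] sum (F a b)) (λ a → ∑[ b < _ ] sum (G a b)))

∑³-distrib-minus : ∀ {n} (F G : Ternary n) →
  ∑³ (λ a b c → F a b c - G a b c) ≡ ∑³ F - ∑³ G
∑³-distrib-minus F G = trans
  (sum-cong-≗ λ a → trans (sum-cong-≗ λ b → ∑-distrib-minus (F a b) (G a b))
                          (∑-distrib-minus (λ b → sum (F a b)) (λ b → sum (G a b))))
  (∑-distrib-minus (λ a → ∑[ b < _ ] sum (F a b)) (λ a → ∑[ b < _ ] sum (G a b)))

sorted : ∀ {n} → Ternary n → Ternary n
sorted F a b c = 𝟙 (does (a <? b)) * (𝟙 (does (b <? c)) * F a b c)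

module _ {n} (F : Ternary n) {a b : Fin n} (c : Fin n) where

  sorted-< : a < b → b < c → sorted F a b c ≡ F a b c
  sorted-< a<b b<c rewrite dec-true (a <? b) a<b | dec-true (b <? c) b<c =
    trans (*-identityˡ _) (*-identityˡ _)

  sorted-≮ˡ : ¬ a < b → sorted F a b c ≡ 0ℤ
  sorted-≮ˡ a≮b rewrite dec-false (a <? b) a≮b = *-zeroˡ (𝟙 (does (b <? c)) * F a b c)

  sorted-≮ʳ : ¬ b < c → sorted F a b c ≡ 0ℤ
  sorted-≮ʳ b≮c rewrite dec-false (b <? c) b≮c | *-zeroˡ (F a b c) = *-zeroʳ (𝟙 (does (a <? b)))

∑³-cong : ∀ {n} {F G : Ternary n} → (∀ a b c → F a b c ≡ G a b c) → ∑³ F ≡ ∑³ G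
∑³-cong F≗G = sum-cong-≗ λ a → sum-cong-≗ λ b → sum-cong-≗ λ c → F≗G a b c

module _ {n} (F : Ternary n)
         (F-rotate     : ∀ a b c → F a b c ≡ F b c a)
         (F-swap       : ∀ a b c → F a b c ≡ F a c b)
         (F-degenerate : ∀ a c → F a a c ≡ 0ℤ) where

  module _ {m M : Fin n} (m<M : m < M)
           (F-off-m : ∀ {a b c} → a ≢ m → b ≢ m → c ≢ m → F a b c ≡ 0ℤ)
           (F-off-M : ∀ {a b c} → a ≢ M → b ≢ M → c ≢ M → F a b c ≡ 0ℤ) where

    private
      -- For a < b < c, the pair m < M can only occupy the positions (b, c), (a, c) or (a, b),
      -- and at most one of them.
      placements : Ternary n
      placements a b c = δ c M * δ b m + δ c M * δ a m + δ b M * δ a m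

      placements-through : ∀ {a b c} → a < b → b < c →
        Dec (a ≡ m) → Dec (b ≡ m) → Dec (c ≡ m) → Dec (b ≡ M) → Dec (c ≡ M) →
        F a b c ≡ 0ℤ ⊎ placements a b c ≡ 1ℤ
      placements-through _ b<c (yes refl) _ _ (yes refl) _
        rewrite δ-≢ (≢-sym (<⇒≢ b<c)) | δ-refl m | δ-refl M = inj₂ refl
      placements-through a<b _ (yes refl) _ _ (no b≢M) (yes refl)
        rewrite δ-≢ (≢-sym (<⇒≢ a<b)) | δ-≢ b≢M | δ-refl m | δ-refl M = inj₂ refl
      placements-through _ _ (yes refl) _ _ (no b≢M) (no c≢M) = inj₁ (F-off-M (<⇒≢ m<M) b≢M c≢M)
      placements-through _ _ (no a≢m) (yes refl) _ _ (yes refl)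
        rewrite δ-≢ a≢m | δ-≢ (<⇒≢ m<M) | δ-refl m | δ-refl M = inj₂ refl
      placements-through a<b _ (no _) (yes refl) _ _ (no c≢M) =
        inj₁ (F-off-M (<⇒≢ (<-trans a<b m<M)) (<⇒≢ m<M) c≢M)
      placements-through a<b b<c (no _) (no _) (yes refl) _ _ =
        inj₁ (F-off-M (<⇒≢ (<-trans (<-trans a<b b<c) m<M)) (<⇒≢ (<-trans b<c m<M)) (<⇒≢ m<M))
      placements-through _ _ (no a≢m) (no b≢m) (no c≢m) _ _ = inj₁ (F-off-m a≢m b≢m c≢m)

      sorted-split : ∀ a b c → sorted F a b c ≡
        δ c M * (δ b m * sorted F a b c) + δ c M * (δ a m * sorted F a b c) + δ b M * (δ a m * sorted F a b c)
      sorted-split a b c = trans (scaled-by-placements a b c (a <? b) (b <? c))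
        (expand (δ c M) (δ b m) (δ a m) (δ b M) (sorted F a b c))
        where
        vanishing : ∀ a b c → sorted F a b c ≡ 0ℤ → sorted F a b c ≡ placements a b c * sorted F a b c
        vanishing a b c u≡0 rewrite u≡0 = sym (*-zeroʳ (placements a b c))

        scaled-by-placements : ∀ a b c → Dec (a < b) → Dec (b < c) →
          sorted F a b c ≡ placements a b c * sorted F a b c
        scaled-by-placements a b c (no a≮b) _ = vanishing a b c (sorted-≮ˡ F c a≮b)
        scaled-by-placements a b c (yes _) (no b≮c) = vanishing a b c (sorted-≮ʳ F c b≮c)
        scaled-by-placements a b c (yes a<b) (yes b<c)
          with placements-through a<b b<c (a ≟ m) (b ≟ m) (c ≟ m) (b ≟ M) (c ≟ M)
        ... | inj₁ F≡0 = vanishing a b c (trans (sorted-< F c a<b b<c) F≡0)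
        ... | inj₂ κ≡1 = sym (trans (cong (_* sorted F a b c) κ≡1) (*-identityˡ _))

        expand : ∀ γ β α β′ u → (γ * β + γ * α + β′ * α) * u ≡ γ * (β * u) + γ * (α * u) + β′ * (α * u)
        expand = solve-∀

      sorted-positions : ∀ x → sorted F x m M + sorted F m x M + sorted F m M x ≡ F m M x
      sorted-positions x with <-cmp x m | <-cmp x M
      ... | tri< x<m _ _ | _ =
        trans (cong₂ _+_ (cong₂ _+_ (trans (sorted-< F M x<m m<M) (F-rotate x m M))
                                    (sorted-≮ˡ F M (<-asym x<m)))
                         (sorted-≮ʳ F x (<-asym (<-trans x<m m<M))))
              (trans (+-identityʳ (F m M x + 0ℤ)) (+-identityʳ (F m M x)))
      ... | tri≈ _ refl _ | _ =
        trans (cong₂ _+_ (cong₂ _+_ (sorted-≮ˡ F M (<-irrefl {x = x} refl)) (sorted-≮ˡ F M (<-irrefl {x = x} refl)))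
                         (sorted-≮ʳ F x (<-asym m<M)))
              (sym (trans (F-swap x M x) (F-degenerate x M)))
      ... | tri> _ _ m<x | tri< x<M _ _ =
        trans (cong₂ _+_ (cong₂ _+_ (sorted-≮ˡ F M (<-asym m<x))
                                    (trans (sorted-< F M m<x x<M) (F-swap m x M)))
                         (sorted-≮ʳ F x (<-asym x<M)))
              (trans (+-identityʳ (0ℤ + F m M x)) (+-identityˡ (F m M x)))
      ... | tri> _ _ _ | tri≈ _ refl _ =
        trans (cong₂ _+_ (cong₂ _+_ (sorted-≮ˡ F x (<-asym m<M)) (sorted-≮ʳ F x (<-irrefl {x = x} refl)))
                         (sorted-≮ʳ F x (<-irrefl {x = x} refl)))
              (sym (trans (F-rotate m x x) (F-degenerate x m)))
      ... | tri> _ _ m<x | tri> _ _ M<x =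
        trans (cong₂ _+_ (cong₂ _+_ (sorted-≮ˡ F M (<-asym m<x)) (sorted-≮ʳ F M (<-asym M<x)))
                         (sorted-< F x m<M M<x))
              (+-identityˡ (F m M x))

    ∑³-sorted-through-< : ∑³ (sorted F) ≡ ∑[ x < n ] F m M x
    ∑³-sorted-through-< = begin
      ∑³ u                                                   ≡⟨ ∑³-cong sorted-split ⟩
      ∑³ (λ a b c → T₁ a b c + T₂ a b c + T₃ a b c)          ≡⟨ ∑³-distrib-+ _ T₃ ⟩
      ∑³ (λ a b c → T₁ a b c + T₂ a b c) + ∑³ T₃              ≡⟨ cong (_+ ∑³ T₃) (∑³-distrib-+ T₁ T₂) ⟩
      ∑³ T₁ + ∑³ T₂ + ∑³ T₃
        ≡⟨ cong₂ _+_ (cong₂ _+_ collapse₁ collapse₂) collapse₃ ⟩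
      ∑[ x < n ] u x m M + ∑[ x < n ] u m x M + ∑[ x < n ] u m M x
        ≡⟨ cong (_+ ∑[ x < n ] u m M x) (∑-distrib-+ (λ x → u x m M) (λ x → u m x M)) ⟨
      ∑[ x < n ] (u x m M + u m x M) + ∑[ x < n ] u m M x
        ≡⟨ ∑-distrib-+ (λ x → u x m M + u m x M) (λ x → u m M x) ⟨
      ∑[ x < n ] (u x m M + u m x M + u m M x)               ≡⟨ sum-cong-≗ sorted-positions ⟩
      ∑[ x < n ] F m M x                                     ∎
      where
      open ≡-Reasoning
      u T₁ T₂ T₃ : Ternary n
      u = sorted F
      T₁ a b c = δ c M * (δ b m * u a b c)
      T₂ a b c = δ c M * (δ a m * u a b c)
      T₃ a b c = δ b M * (δ a m * u a b c)

      collapse₁ : ∑³ T₁ ≡ ∑[ x < n ] u x m M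
      collapse₁ = sum-cong-≗ λ a →
        trans (sum-cong-≗ λ b → ∑-δ M (λ c → δ b m * u a b c)) (∑-δ m (λ b → u a b M))

      collapse₂ : ∑³ T₂ ≡ ∑[ x < n ] u m x M
      collapse₂ = trans (sum-cong-≗ λ a →
        trans (sum-cong-≗ λ b → ∑-δ M (λ c → δ a m * u a b c))
              (sym (*-distribˡ-sum (δ a m) (λ b → u a b M))))
        (∑-δ m (λ a → ∑[ b < n ] u a b M))

      collapse₃ : ∑³ T₃ ≡ ∑[ x < n ] u m M x
      collapse₃ = trans (sum-cong-≗ λ a →
        trans (sum-cong-≗ λ b → sym (*-distribˡ-sum (δ b M) (λ c → δ a m * u a b c)))
              (trans (∑-δ M (λ b → ∑[ c < n ] (δ a m * u a b c)))
                     (sym (*-distribˡ-sum (δ a m) (u a M)))))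
        (∑-δ m (λ a → sum (u a M)))

  ∑³-sorted-through : ∀ {p q} → p ≢ q →
    (∀ {a b c} → a ≢ p → b ≢ p → c ≢ p → F a b c ≡ 0ℤ) →
    (∀ {a b c} → a ≢ q → b ≢ q → c ≢ q → F a b c ≡ 0ℤ) →
    ∑³ (sorted F) ≡ ∑[ x < n ] F p q x
  ∑³-sorted-through {p} {q} p≢q F-off-p F-off-q with <-cmp p q
  ... | tri< p<q _ _ = ∑³-sorted-through-< p<q F-off-p F-off-q
  ... | tri≈ _ p≡q _ = ⊥-elim (p≢q p≡q)
  ... | tri> _ _ q<p = trans (∑³-sorted-through-< q<p F-off-q F-off-p)
                             (sum-cong-≗ λ x → trans (F-rotate q p x) (F-swap p x q))

indeg≡∑ : ∀ {n} (E : Digraph n) u → + indeg E u ≡ ∑[ x < n ] 𝟙 (E x u)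
indeg≡∑ {n} E u = trans (length-filter (λ x → E x u Bool.≟ true) (allFin n))
  (trans (∑ₗ-allFin (λ x → 𝟙 (does (E x u Bool.≟ true))))
         (sum-cong-≗ λ x → 𝟙-does-≟-true (E x u)))

𝟙-isCyclic : ∀ {n} → Digraph n → Ternary n
𝟙-isCyclic E a b c = 𝟙 (isCyclic E a b c)

c3≡∑³ : ∀ {n} (E : Digraph n) → + c3 E ≡ ∑³ (sorted (𝟙-isCyclic E))
c3≡∑³ {n} E = begin
  + c3 E
    ≡⟨ length-filter cyclic? (triples n) ⟩
  ∑ₗ weight (triples n)
    ≡⟨ ∑ₗ-concatMap weight (λ a → concatMap (triplesFrom a) (later a)) (allFin n) ⟩
  ∑ₗ (λ a → ∑ₗ weight (concatMap (triplesFrom a) (later a))) (allFin n)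
    ≡⟨ ∑ₗ-allFin (λ a → ∑ₗ weight (concatMap (triplesFrom a) (later a))) ⟩
  ∑[ a < n ] ∑ₗ weight (concatMap (triplesFrom a) (later a))
    ≡⟨ sum-cong-≗ outer ⟩
  ∑[ a < n ] ∑[ b < n ] (𝟙 (does (a <? b)) * ∑[ c < n ] (𝟙 (does (b <? c)) * 𝟙-isCyclic E a b c))
    ≡⟨ sum-cong-≗ (λ a → sum-cong-≗ λ b →
         *-distribˡ-sum (𝟙 (does (a <? b))) (λ c → 𝟙 (does (b <? c)) * 𝟙-isCyclic E a b c)) ⟩
  ∑³ (sorted (𝟙-isCyclic E)) ∎
  where
  open ≡-Reasoning
  cyclic? : Decidable (λ ((a , b , c) : Fin n × Fin n × Fin n) → isCyclic E a b c ≡ true)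
  cyclic? (a , b , c) = isCyclic E a b c Bool.≟ true

  weight : Fin n × Fin n × Fin n → ℤ
  weight t = 𝟙 (does (cyclic? t))

  later : Fin n → List (Fin n)
  later a = filter (a <?_) (allFin n)

  triplesFrom : Fin n → Fin n → List (Fin n × Fin n × Fin n)
  triplesFrom a b = map (λ c → (a , b , c)) (later b)

  inner : ∀ a b → ∑ₗ weight (triplesFrom a b) ≡ ∑[ c < n ] (𝟙 (does (b <? c)) * 𝟙-isCyclic E a b c)
  inner a b = begin
    ∑ₗ weight (triplesFrom a b)
      ≡⟨ ∑ₗ-map weight (λ c → (a , b , c)) (later b) ⟩
    ∑ₗ (λ c → weight (a , b , c)) (later b)
      ≡⟨ ∑ₗ-filter (b <?_) (λ c → weight (a , b , c)) (allFin n) ⟩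
    ∑ₗ (λ c → 𝟙 (does (b <? c)) * weight (a , b , c)) (allFin n)
      ≡⟨ ∑ₗ-allFin (λ c → 𝟙 (does (b <? c)) * weight (a , b , c)) ⟩
    ∑[ c < n ] (𝟙 (does (b <? c)) * weight (a , b , c))
      ≡⟨ sum-cong-≗ (λ c → cong (_*_ (𝟙 (does (b <? c)))) (𝟙-does-≟-true (isCyclic E a b c))) ⟩
    ∑[ c < n ] (𝟙 (does (b <? c)) * 𝟙-isCyclic E a b c) ∎

  outer : ∀ a → ∑ₗ weight (concatMap (triplesFrom a) (later a)) ≡
    ∑[ b < n ] (𝟙 (does (a <? b)) * ∑[ c < n ] (𝟙 (does (b <? c)) * 𝟙-isCyclic E a b c))
  outer a = begin
    ∑ₗ weight (concatMap (triplesFrom a) (later a))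
      ≡⟨ ∑ₗ-concatMap weight (triplesFrom a) (later a) ⟩
    ∑ₗ (∑ₗ weight ∘ triplesFrom a) (later a)
      ≡⟨ ∑ₗ-filter (a <?_) (∑ₗ weight ∘ triplesFrom a) (allFin n) ⟩
    ∑ₗ (λ b → 𝟙 (does (a <? b)) * ∑ₗ weight (triplesFrom a b)) (allFin n)
      ≡⟨ ∑ₗ-allFin (λ b → 𝟙 (does (a <? b)) * ∑ₗ weight (triplesFrom a b)) ⟩
    ∑[ b < n ] (𝟙 (does (a <? b)) * ∑ₗ weight (triplesFrom a b))
      ≡⟨ sum-cong-≗ (λ b → cong (_*_ (𝟙 (does (a <? b)))) (inner a b)) ⟩
    ∑[ b < n ] (𝟙 (does (a <? b)) * ∑[ c < n ] (𝟙 (does (b <? c)) * 𝟙-isCyclic E a b c)) ∎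

module _ {n} (E : Digraph n) where

  isCyclic-rotate : ∀ a b c → isCyclic E a b c ≡ isCyclic E b c a
  isCyclic-rotate a b c = cong₂ _∨_
    (trans (∧-comm (E a b) _) (∧-assoc (E b c) (E c a) (E a b)))
    (sym (trans (∧-comm (E b a) _) (∧-assoc (E a c) (E c b) (E b a))))

  isCyclic-swap : ∀ a b c → isCyclic E a b c ≡ isCyclic E a c b
  isCyclic-swap a b c = ∨-comm (E a b ∧ E b c ∧ E c a) (E a c ∧ E c b ∧ E b a)

  isCyclic-degenerate : ∀ {a} c → E a a ≡ false → isCyclic E a a c ≡ false
  isCyclic-degenerate {a} c Eaa≡false rewrite Eaa≡false | ∧-zeroʳ (E c a) = ∧-zeroʳ (E a c)

  isCyclic-through : ∀ {a b} c → E a b ≡ true → E b a ≡ false → isCyclic E a b c ≡ (E b c ∧ E c a)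
  isCyclic-through {a} {b} c Eab Eba
    rewrite Eab | Eba | ∧-zeroʳ (E c b) | ∧-zeroʳ (E a c) = ∨-identityʳ (E b c ∧ E c a)

isCyclic-cong-on : ∀ {n} {E E′ : Digraph n} (P : Fin n → Set) →
  (∀ {x y} → P x → P y → E x y ≡ E′ x y) →
  ∀ {a b c} → P a → P b → P c → isCyclic E a b c ≡ isCyclic E′ a b c
isCyclic-cong-on P E≗E′ pa pb pc = cong₂ _∨_
  (cong₂ _∧_ (E≗E′ pa pb) (cong₂ _∧_ (E≗E′ pb pc) (E≗E′ pc pa)))
  (cong₂ _∧_ (E≗E′ pa pc) (cong₂ _∧_ (E≗E′ pc pb) (E≗E′ pb pa)))

module _ {n} (σ : Digraph n) (v w : Fin n) where

  reverseEdge-vw : reverseEdge σ v w v w ≡ σ w v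
  reverseEdge-vw with v ≟ v | w ≟ w
  ... | yes _   | yes _   = refl
  ... | no v≢v  | _       = ⊥-elim (v≢v refl)
  ... | yes _   | no w≢w  = ⊥-elim (w≢w refl)

  reverseEdge-wv : reverseEdge σ v w w v ≡ σ v w
  reverseEdge-wv with w ≟ v | v ≟ w | w ≟ w | v ≟ v
  ... | yes _ | yes _ | _     | _     = refl
  ... | no _  | _     | yes _ | yes _ = refl
  ... | yes _ | no _  | yes _ | yes _ = refl
  ... | _     | _     | no w≢w | _     = ⊥-elim (w≢w refl)
  ... | _     | _     | yes _  | no v≢v = ⊥-elim (v≢v refl)

  reverseEdge-diagonal : ∀ x → reverseEdge σ v w x x ≡ σ x x
  reverseEdge-diagonal x with (⌊ x ≟ v ⌋ ∧ ⌊ x ≟ w ⌋) ∨ (⌊ x ≟ w ⌋ ∧ ⌊ x ≟ v ⌋)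
  ... | true  = refl
  ... | false = refl

  reverseEdge-comm : ∀ x y → reverseEdge σ v w x y ≡ reverseEdge σ w v x y
  reverseEdge-comm x y = cong (λ b → if b then σ y x else σ x y)
    (∨-comm (⌊ x ≟ v ⌋ ∧ ⌊ y ≟ w ⌋) (⌊ x ≟ w ⌋ ∧ ⌊ y ≟ v ⌋))

  reverseEdge-unchanged : ∀ {x y} → ¬ (x ≡ v × y ≡ w) → ¬ (x ≡ w × y ≡ v) →
    reverseEdge σ v w x y ≡ σ x y
  reverseEdge-unchanged {x} {y} ¬vw ¬wv with x ≟ v | y ≟ w | x ≟ w | y ≟ v
  ... | yes x≡v | yes y≡w | _       | _       = ⊥-elim (¬vw (x≡v , y≡w))
  ... | _       | _       | yes x≡w | yes y≡v = ⊥-elim (¬wv (x≡w , y≡v))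
  ... | no _    | _       | no _    | _       = refl
  ... | no _    | _       | yes _   | no _    = refl
  ... | yes _   | no _    | no _    | _       = refl
  ... | yes _   | no _    | yes _   | no _    = refl

cyclicChange : ∀ {n} → Digraph n → Digraph n → Ternary n
cyclicChange σ τ a b c = 𝟙-isCyclic τ a b c - 𝟙-isCyclic σ a b c

module _ {n} (σ τ : Digraph n) where

  cyclicChange-rotate : ∀ a b c → cyclicChange σ τ a b c ≡ cyclicChange σ τ b c a
  cyclicChange-rotate a b c =
    cong₂ (λ s t → 𝟙 s - 𝟙 t) (isCyclic-rotate τ a b c) (isCyclic-rotate σ a b c)

  cyclicChange-swap : ∀ a b c → cyclicChange σ τ a b c ≡ cyclicChange σ τ a c b
  cyclicChange-swap a b c =
    cong₂ (λ s t → 𝟙 s - 𝟙 t) (isCyclic-swap τ a b c) (isCyclic-swap σ a b c)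

  cyclicChange-unchanged : ∀ {a b c} → isCyclic τ a b c ≡ isCyclic σ a b c → cyclicChange σ τ a b c ≡ 0ℤ
  cyclicChange-unchanged {a} {b} {c} same =
    trans (cong (λ s → 𝟙 s - 𝟙-isCyclic σ a b c) same) (+-inverseʳ (𝟙-isCyclic σ a b c))

  c3-difference : + c3 τ - + c3 σ ≡ ∑³ (sorted (cyclicChange σ τ))
  c3-difference = begin
    + c3 τ - + c3 σ                                              ≡⟨ cong₂ _-_ (c3≡∑³ τ) (c3≡∑³ σ) ⟩
    ∑³ (sorted (𝟙-isCyclic τ)) - ∑³ (sorted (𝟙-isCyclic σ))
      ≡⟨ ∑³-distrib-minus (sorted (𝟙-isCyclic τ)) (sorted (𝟙-isCyclic σ)) ⟨
    ∑³ (λ a b c → sorted (𝟙-isCyclic τ) a b c - sorted (𝟙-isCyclic σ) a b c)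
      ≡⟨ ∑³-cong (λ a b c → factor-out (𝟙 (does (a <? b))) (𝟙 (does (b <? c)))
                                        (𝟙-isCyclic τ a b c) (𝟙-isCyclic σ a b c)) ⟩
    ∑³ (sorted (cyclicChange σ τ))                               ∎
    where
    open ≡-Reasoning
    factor-out : ∀ p q s t → p * (q * s) - p * (q * t) ≡ p * (q * (s - t))
    factor-out = solve-∀

c3-cong : ∀ {n} {E E′ : Digraph n} → (∀ x y → E x y ≡ E′ x y) → + c3 E ≡ + c3 E′
c3-cong {E = E} {E′} E≗E′ = trans (c3≡∑³ E) (trans (∑³-cong same-sorted) (sym (c3≡∑³ E′)))
  where
  same-sorted : ∀ a b c → sorted (𝟙-isCyclic E) a b c ≡ sorted (𝟙-isCyclic E′) a b c
  same-sorted a b c = cong (λ s → 𝟙 (does (a <? b)) * (𝟙 (does (b <? c)) * 𝟙 s))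
    (isCyclic-cong-on (λ _ → ⊤) (λ {x} {y} _ _ → E≗E′ x y) tt tt tt)

module _ {n} {σ : Digraph n} (tournament : IsTournament σ) where
  open IsTournament tournament

  converse : ∀ {x y} → x ≢ y → σ y x ≡ not (σ x y)
  converse {x} {y} x≢y with σ x y in σxy
  ... | true  = antisym x y σxy
  ... | false = complete x y x≢y σxy

  module _ {v w : Fin n} (v≢w : v ≢ w) where
    private
      τ : Digraph n
      τ = reverseEdge σ v w

      cyclicChange-avoiding : ∀ {u} → u ≡ v ⊎ u ≡ w →
        ∀ {a b c} → a ≢ u → b ≢ u → c ≢ u → cyclicChange σ τ a b c ≡ 0ℤ
      cyclicChange-avoiding u∈vw a≢u b≢u c≢u = cyclicChange-unchanged σ τ
        (isCyclic-cong-on (_≢ _) (λ x≢u y≢u → reverseEdge-unchanged σ v w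
            (λ (x≡v , y≡w) → avoid u∈vw x≢u y≢u x≡v y≡w)
            (λ (x≡w , y≡v) → avoid u∈vw y≢u x≢u y≡v x≡w))
          a≢u b≢u c≢u)
        where
        avoid : ∀ {u x y} → u ≡ v ⊎ u ≡ w → x ≢ u → y ≢ u → x ≡ v → y ≡ w → ⊥
        avoid (inj₁ refl) x≢u _ x≡v _ = x≢u x≡v
        avoid (inj₂ refl) _ y≢u _ y≡w = y≢u y≡w

      cyclicChange-degenerate : ∀ a c → cyclicChange σ τ a a c ≡ 0ℤ
      cyclicChange-degenerate a c = cyclicChange-unchanged σ τ (trans
        (isCyclic-degenerate τ c (trans (reverseEdge-diagonal σ v w a) (irreflexive a)))
        (sym (isCyclic-degenerate σ c (irreflexive a))))

      module _ (σvw : σ v w ≡ true) where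
        cyclicChange-third : ∀ {x} → x ≢ v → x ≢ w → cyclicChange σ τ v w x ≡ 𝟙 (σ x w) - 𝟙 (σ x v)
        cyclicChange-third {x} x≢v x≢w = begin
          𝟙 (isCyclic τ v w x) - 𝟙 (isCyclic σ v w x)      ≡⟨ cong₂ (λ s t → 𝟙 s - 𝟙 t) τ-cyclic σ-cyclic ⟩
          𝟙 (not (σ x v) ∧ σ x w) - 𝟙 (not (σ x w) ∧ σ x v) ≡⟨ 𝟙-not-∧-difference (σ x v) (σ x w) ⟩
          𝟙 (σ x w) - 𝟙 (σ x v)                             ∎
          where
          open ≡-Reasoning
          σ-cyclic : isCyclic σ v w x ≡ not (σ x w) ∧ σ x v
          σ-cyclic = trans (isCyclic-through σ x σvw (antisym v w σvw)) (cong (_∧ σ x v) (converse x≢w))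

          τ-cyclic : isCyclic τ v w x ≡ not (σ x v) ∧ σ x w
          τ-cyclic = begin
            isCyclic τ v w x   ≡⟨ trans (isCyclic-rotate τ v w x) (isCyclic-swap τ w x v) ⟩
            isCyclic τ w v x   ≡⟨ isCyclic-through τ x (trans (reverseEdge-wv σ v w) σvw)
                                    (trans (reverseEdge-vw σ v w) (antisym v w σvw)) ⟩
            τ v x ∧ τ x w
              ≡⟨ cong₂ _∧_
                   (reverseEdge-unchanged σ v w (λ (_ , x≡w) → x≢w x≡w) (λ (v≡w , _) → v≢w v≡w))
                   (reverseEdge-unchanged σ v w (λ (x≡v , _) → x≢v x≡v) (λ (_ , w≡v) → v≢w (sym w≡v))) ⟩
            σ v x ∧ σ x w      ≡⟨ cong (_∧ σ x w) (converse x≢v) ⟩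
            not (σ x v) ∧ σ x w ∎

        cyclicChange-at : ∀ x → Dec (x ≡ v) → Dec (x ≡ w) →
          cyclicChange σ τ v w x ≡ 𝟙 (σ x w) - 𝟙 (σ x v) - δ x v
        cyclicChange-at _ (yes refl) _ =
          trans (trans (cyclicChange-swap σ τ v w v) (cyclicChange-degenerate v w)) (sym at-v)
          where
          at-v : 𝟙 (σ v w) - 𝟙 (σ v v) - δ v v ≡ 0ℤ
          at-v rewrite σvw | irreflexive v | δ-refl v = refl
        cyclicChange-at _ (no _) (yes refl) =
          trans (trans (cyclicChange-rotate σ τ v w w) (cyclicChange-degenerate w v)) (sym at-w)
          where
          at-w : 𝟙 (σ w w) - 𝟙 (σ w v) - δ w v ≡ 0ℤ
          at-w rewrite irreflexive w | antisym v w σvw | δ-≢ (≢-sym v≢w) = refl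
        cyclicChange-at x (no x≢v) (no x≢w) = begin
          cyclicChange σ τ v w x            ≡⟨ cyclicChange-third x≢v x≢w ⟩
          𝟙 (σ x w) - 𝟙 (σ x v)             ≡⟨ +-identityʳ _ ⟨
          𝟙 (σ x w) - 𝟙 (σ x v) - 0ℤ        ≡⟨ cong (λ d → 𝟙 (σ x w) - 𝟙 (σ x v) - d) (δ-≢ x≢v) ⟨
          𝟙 (σ x w) - 𝟙 (σ x v) - δ x v     ∎
          where open ≡-Reasoning

    c3-reverseEdge : σ v w ≡ true → + c3 (reverseEdge σ v w) - + c3 σ ≡ (+ indeg σ w - + indeg σ v) - 1ℤ
    c3-reverseEdge σvw = begin
      + c3 τ - + c3 σ
        ≡⟨ c3-difference σ τ ⟩
      ∑³ (sorted (cyclicChange σ τ))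
        ≡⟨ ∑³-sorted-through (cyclicChange σ τ) (cyclicChange-rotate σ τ) (cyclicChange-swap σ τ)
             cyclicChange-degenerate v≢w (cyclicChange-avoiding (inj₁ refl)) (cyclicChange-avoiding (inj₂ refl)) ⟩
      ∑[ x < n ] cyclicChange σ τ v w x
        ≡⟨ sum-cong-≗ (λ x → cyclicChange-at σvw x (x ≟ v) (x ≟ w)) ⟩
      ∑[ x < n ] (𝟙 (σ x w) - 𝟙 (σ x v) - δ x v)
        ≡⟨ ∑-distrib-minus (λ x → 𝟙 (σ x w) - 𝟙 (σ x v)) (λ x → δ x v) ⟩
      ∑[ x < n ] (𝟙 (σ x w) - 𝟙 (σ x v)) - ∑[ x < n ] δ x v
        ≡⟨ cong₂ _-_ (∑-distrib-minus (λ x → 𝟙 (σ x w)) (λ x → 𝟙 (σ x v))) (∑-δ-one v) ⟩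
      ∑[ x < n ] 𝟙 (σ x w) - ∑[ x < n ] 𝟙 (σ x v) - 1ℤ
        ≡⟨ cong (_- 1ℤ) (cong₂ _-_ (indeg≡∑ σ w) (indeg≡∑ σ v)) ⟨
      + indeg σ w - + indeg σ v - 1ℤ ∎
      where open ≡-Reasoning

proposition2 : (n : ℕ) (σ : Digraph n) → IsTournament σ →
    (v w : Fin n) → v ≢ w → sd σ w ≤ sd σ v →
    let k = (+ indeg σ w) - (+ indeg σ v)
        τ = reverseEdge σ v w
    in (σ v w ≡ true → (+ c3 τ) - (+ c3 σ) ≡ k - 1ℤ)
     × (σ w v ≡ true → (+ c3 σ) - (+ c3 τ) ≡ k + 1ℤ)
proposition2 n σ tournament v w v≢w _ = c3-reverseEdge tournament v≢w , c3-unreverseEdge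
  where
  open ≡-Reasoning
  c3-unreverseEdge : σ w v ≡ true → + c3 σ - + c3 (reverseEdge σ v w) ≡ (+ indeg σ w - + indeg σ v) + 1ℤ
  c3-unreverseEdge σwv = begin
    + c3 σ - + c3 (reverseEdge σ v w)            ≡⟨ cong (_-_ (+ c3 σ)) (c3-cong (reverseEdge-comm σ v w)) ⟩
    + c3 σ - + c3 (reverseEdge σ w v)            ≡⟨ swap-sides (+ c3 σ) (+ c3 (reverseEdge σ w v)) ⟩
    - (+ c3 (reverseEdge σ w v) - + c3 σ)        ≡⟨ cong -_ (c3-reverseEdge tournament (≢-sym v≢w) σwv) ⟩
    - (+ indeg σ v - + indeg σ w - 1ℤ)           ≡⟨ negate (+ indeg σ v) (+ indeg σ w) ⟩
    + indeg σ w - + indeg σ v + 1ℤ               ∎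
    where
    swap-sides : ∀ a b → a - b ≡ - (b - a)
    swap-sides = solve-∀
    negate : ∀ a b → - (a - b - 1ℤ) ≡ b - a + 1ℤ
    negate = solve-∀
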